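{- Let $n\geq 1$ and $d\geq 0$. Then \[ \mathsf{ITC}_{n,d} = \{[(d),(n)]\} \cup \bigcup_{k\geq 2}\left\{ [(b_1,\ldots,b_k),(a_1,\ldots,a_k)] \;:\; \begin{array}{l} b_1,\ldots,b_k\geq 0,\ b_1+\cdots+b_k=d,\\ a_1,\ldots,a_k\geq 0,\ a_1+\cdots+a_k=n,\\ a_1,\ldots,a_{k-1}>0,\ \text{and } b_k+a_k>0\end{array}\right\}. \]
   Context: The complete split graph $S_{n,d}$ has vertices $s,v_1,\ldots,v_n$ (the clique part together with the sink $s$) and $w_1,\ldots,w_d$ (the independent part); any two distinct vertices among $s,v_1,\ldots,v_n$ are adjacent, each $w_j$ is adjacent to every one of $s,v_1,\ldots,v_n$, and no two $w_j$'s are adjacent. Thus $\deg(v_i)=n+d$ and $\deg(w_j)=n+1$. The vertex $s$ is the sink. A configuration assigns a non-negative integer (number of grains) to each non-sink vertex; it is written $(c(v_1),\ldots,c(v_n);c(w_1),\ldots,c(w_d))$. A non-sink vertex $v$ is unstable if $c(v)\geq\deg(v)$; toppling a vertex $v$ removes $\deg(v)$ grains from $v$ (if $v\neq s$) and adds one grain to each non-sink neighbour of $v$ (the sink absorbs grains). A configuration is stable if every non-sink vertex is stable. A stable configuration $c$ is recurrent iff there is an ordering $s=u_0,u_1,\ldots,u_{n+d}$ of all vertices such that, starting from $c$ and toppling $u_0,\ldots,u_{i-1}$ in turn, the vertex $u_i$ is unstable for every $i\geq 1$. $\mathsf{SortedRec}(S_{n,d})$ is the set of recurrent configurations with $c(v_1)\geq\cdots\geq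 c(v_n)$ and $c(w_1)\geq\cdots\geq c(w_d)$. ITC toppling of $c\in\mathsf{SortedRec}(S_{n,d})$: topple the sink; then for $i=1,2,\ldots$: let $Q'_i$ be the set of currently unstable independent vertices and topple all of them simultaneously; then let $P'_i$ be the set of currently unstable clique vertices $v_j$ and topple all of them simultaneously; stop after the first $i$ (call it $k$) at which the resulting configuration is stable. Set $q'_i=|Q'_i|$, $p'_i=|P'_i|$ and $\mathsf{topple}_{ITC}(c)=(q'_1,p'_1,\ldots,q'_k,p'_k)$. The pair $[(q'_1,\ldots,q'_k),(p'_1,\ldots,p'_k)]$ is the ITC-toppling sequence of $c$ (of length $k$). $\mathsf{ITC}_{n,d,k}$ is the set of all ITC-toppling sequences of length $k$ of configurations in $\mathsf{SortedRec}(S_{n,d})$, and $\mathsf{ITC}_{n,d}=\bigcup_{k\geq1}\mathsf{ITC}_{n,d,k}$. -}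

module Defs where

open import Data.Nat using (ℕ; zero; suc; _+_; _∸_; _≤_; _<_; _≤ᵇ_)
open import Data.Bool using (Bool; true; false; _∧_; not; if_then_else_)
open import Data.Fin using (Fin) renaming (_≤_ to _≤F_)
import Data.Fin.Properties as FinP
open import Data.Sum using (_⊎_; inj₁; inj₂)
open import Data.Sum.Properties using (≡-dec)
open import Data.Product using (Σ; _×_; ∃-syntax)
open import Data.List using (List; []; _∷_)
open import Data.List.Relation.Unary.Unique.Propositional using (Unique)
open import Data.List.Membership.Propositional using (_∈_)
open import Data.Unit using (⊤)
open import Relation.Nullary using (¬_)
open import Relation.Nullary.Decidable using (⌊_⌋)

-- Non-sink vertices of S_{n,d}: inj₁ i = v_{i+1} (clique), inj₂ j = w_{j+1} (independent).
V : ℕ → ℕ → Set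
V n d = Fin n ⊎ Fin d

Config : ℕ → ℕ → Set
Config n d = V n d → ℕ

deg : ∀ {n d} → V n d → ℕ
deg {n} {d} (inj₁ _) = n + d
deg {n} {d} (inj₂ _) = n + 1

adj : ∀ {n d} → V n d → V n d → Bool
adj (inj₁ i) (inj₁ j) = not ⌊ FinP._≟_ i j ⌋
adj (inj₁ _) (inj₂ _) = true
adj (inj₂ _) (inj₁ _) = true
adj (inj₂ _) (inj₂ _) = false

isClique : ∀ {n d} → V n d → Bool
isClique (inj₁ _) = true
isClique (inj₂ _) = false

isIndep : ∀ {n d} → V n d → Bool
isIndep x = not (isClique x)

countFin : ∀ {m} → (Fin m → Bool) → ℕ
countFin {zero} P = 0
countFin {suc m} P = (if P Fin.zero then 1 else 0) + countFin (λ i → P (Fin.suc i))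

countV : ∀ {n d} → (V n d → Bool) → ℕ
countV P = countFin (λ i → P (inj₁ i)) + countFin (λ j → P (inj₂ j))

toppleSink : ∀ {n d} → Config n d → Config n d
toppleSink c x = suc (c x)

-- simultaneous toppling of the set S of non-sink vertices
-- (only applied to sets of unstable vertices, so ∸ is exact subtraction)
toppleSet : ∀ {n d} → (V n d → Bool) → Config n d → Config n d
toppleSet S c x = (c x ∸ (if S x then deg x else 0)) + countV (λ y → S y ∧ adj y x)

toppleOne : ∀ {n d} → V n d → Config n d → Config n d
toppleOne u = toppleSet (λ y → ⌊ ≡-dec FinP._≟_ FinP._≟_ y u ⌋)

unstable : ∀ {n d} → Config n d → V n d → Bool
unstable c x = deg x ≤ᵇ c x

Stable : ∀ {n d} → Config n d → Set
Stable c = ∀ x → c x < deg x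

ValidSeq : ∀ {n d} → Config n d → List (V n d) → Set
ValidSeq c [] = ⊤
ValidSeq c (u ∷ us) = (deg u ≤ c u) × ValidSeq (toppleOne u c) us

Recurrent : ∀ {n d} → Config n d → Set
Recurrent {n} {d} c =
  Stable c × ∃[ us ] (Unique us × (∀ (x : V n d) → x ∈ us) × ValidSeq (toppleSink c) us)

Sorted : ∀ {n d} → Config n d → Set
Sorted {n} {d} c =
  (∀ (i j : Fin n) → i ≤F j → c (inj₁ j) ≤ c (inj₁ i)) ×
  (∀ (i j : Fin d) → i ≤F j → c (inj₂ j) ≤ c (inj₂ i))

SortedRec : ∀ {n d} → Config n d → Set
SortedRec c = Sorted c × Recurrent c

Qset : ∀ {n d} → Config n d → V n d → Bool
Qset c x = isIndep x ∧ unstable c x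

afterQ : ∀ {n d} → Config n d → Config n d
afterQ c = toppleSet (Qset c) c

Pset : ∀ {n d} → Config n d → V n d → Bool
Pset c x = isClique x ∧ unstable (afterQ c) x

afterRound : ∀ {n d} → Config n d → Config n d
afterRound c = toppleSet (Pset c) (afterQ c)

qRound pRound : ∀ {n d} → Config n d → ℕ
qRound c = countV (Qset c)
pRound c = countV (Pset c)

data ITCFrom {n d : ℕ} (c : Config n d) : List ℕ → List ℕ → Set where
  stop : Stable (afterRound c) → ITCFrom c (qRound c ∷ []) (pRound c ∷ [])
  more : ∀ {qs ps} → ¬ Stable (afterRound c) → ITCFrom (afterRound c) qs ps →
         ITCFrom c (qRound c ∷ qs) (pRound c ∷ ps)

ITCSeq : ∀ {n d} → Config n d → List ℕ → List ℕ → Set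
ITCSeq c qs ps = ITCFrom (toppleSink c) qs ps

InITC : ℕ → ℕ → List ℕ → List ℕ → Set
InITC n d qs ps = Σ (Config n d) (λ c → SortedRec c × ITCSeq c qs ps)

-- Start from a stable c0, topple the sink, and then topple vertices, each at most once.  The
-- configuration reached depends only on the set R of vertices toppled (Toppled below), and
-- the vertices of R are stable again.  Hence the ITC rounds topple disjoint sets, a round
-- without clique topplings ends in a stable configuration, and the first round from an
-- unstable configuration topples something; this gives the positivity conditions.  If c0 is
-- recurrent, comparing with a recurrence ordering (least action) shows that the rounds
-- topple every vertex, so the q's sum to d and the p's to n; conversely, if they do, listing
-- the vertices of each round in turn is a recurrence ordering.
-- For the reverse inclusion, schedule the independent blocks b₁, …, b_k and the clique
-- blocks a₁, …, a_k alternately and give each vertex deg − 1 grains minus the number of its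
-- neighbours scheduled before it.  Every vertex then becomes unstable exactly in its own
-- block, since a_r > 0 for r < k keeps the later blocks stable, and the configuration is
-- sorted because the number of earlier neighbours grows along the blocks.

{-# OPTIONS --safe #-}
module Submission where

open import Defs
open import Data.Bool using (Bool; true; false; _∧_; _∨_; not; if_then_else_)
open import Data.Bool.Properties
  using (¬-not; ∧-zeroʳ; ∧-identityʳ; ∧-distribʳ-∨; ∨-identityʳ; ∨-zeroʳ; ∨-conicalˡ; ∨-conicalʳ)
import Data.Bool.Properties as Bool
open import Data.Fin using (Fin; toℕ; splitAt; join) renaming (zero to fzero; suc to fsuc)
import Data.Fin.Properties as Fin
open import Data.List using (List; []; _∷_; _++_; length; map; filter; allFin)
open import Data.List.Membership.Propositional using (_∈_)
open import Data.List.Membership.Propositional.Properties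
  using (∈-map⁺; ∈-allFin; ∈-filter⁺; ∈-filter⁻; ∈-++⁺ˡ; ∈-++⁺ʳ; ∈-++⁻)
open import Data.List.Relation.Unary.All using (All; []; _∷_; lookup)
open import Data.List.Relation.Unary.AllPairs using ([]; _∷_)
open import Data.List.Relation.Unary.Any using (here; there)
open import Data.List.Relation.Unary.Unique.Propositional using (Unique)
import Data.List.Relation.Unary.Unique.Propositional.Properties as Unique
open import Data.Nat using (ℕ; zero; suc; _+_; _∸_; _≤_; _<_; _<ᵇ_; z≤n; s≤s; s≤s⁻¹)
open import Data.Nat.ListAction using (sum)
open import Data.Nat.Properties
open import Data.Product using (_×_; _,_; proj₂; ∃-syntax)
open import Data.Sum using (_⊎_; inj₁; inj₂; [_,_]; map₂)
open import Data.Sum.Properties using (≡-dec)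
open import Function.Base using (_∘_; id; _⟨_⟩_)
open import Function.Bundles using (_⇔_; mk⇔; Equivalence)
import Function.Properties.Equivalence as ⇔
open import Relation.Binary.PropositionalEquality
  using (_≡_; _≗_; refl; sym; trans; cong; cong₂; subst; subst₂; module ≡-Reasoning)
open import Relation.Nullary using (¬_; Dec; yes; no; does; _because_; _⊎-dec_; contradiction)
open import Relation.Nullary.Reflects using (ofʸ; ofⁿ)
open import Relation.Nullary.Decidable using (⌊_⌋; dec-true; dec-false; does-⇔)
open import Algebra.Properties.CommutativeSemigroup +-commutativeSemigroup using (interchange; xy∙z≈xz∙y)

private
  variable
    n d m : ℕ

dec-true⁻ : ∀ {A : Set} (a? : Dec A) → does a? ≡ true → A
dec-true⁻ (true because ofʸ a) refl = a

dec-false⁻ : ∀ {A : Set} (a? : Dec A) → does a? ≡ false → ¬ A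
dec-false⁻ (false because ofⁿ ¬a) refl = ¬a

≡true⇔⇒≡ : ∀ {a b} → (a ≡ true ⇔ b ≡ true) → a ≡ b
≡true⇔⇒≡ {true}  a⇔b = sym (Equivalence.to a⇔b refl)
≡true⇔⇒≡ {false} {true}  a⇔b = Equivalence.from a⇔b refl
≡true⇔⇒≡ {false} {false} _   = refl

⌊⌋-yes : ∀ {A : Set} (a? : Dec A) → A → ⌊ a? ⌋ ≡ true
⌊⌋-yes (yes _) _ = refl
⌊⌋-yes (no ¬a) a = contradiction a ¬a

⌊⌋-no : ∀ {A : Set} (a? : Dec A) → ¬ A → ⌊ a? ⌋ ≡ false
⌊⌋-no (yes a) ¬a = contradiction a ¬a
⌊⌋-no (no _) _ = refl

⌊⌋-yes⁻ : ∀ {A : Set} (a? : Dec A) → ⌊ a? ⌋ ≡ true → A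
⌊⌋-yes⁻ (yes a) _ = a

<ᵇ-true : ∀ {k l} → k < l → (k <ᵇ l) ≡ true
<ᵇ-true = dec-true (_ <? _)

<ᵇ-false : ∀ {k l} → l ≤ k → (k <ᵇ l) ≡ false
<ᵇ-false l≤k = dec-false (_ <? _) (≤⇒≯ l≤k)

countFin-cong : {P Q : Fin m → Bool} → P ≗ Q → countFin P ≡ countFin Q
countFin-cong {zero} P≗Q = refl
countFin-cong {suc m} P≗Q = cong₂ _+_ (cong (λ b → if b then 1 else 0) (P≗Q fzero)) (countFin-cong (P≗Q ∘ fsuc))

countFin-false : countFin {m} (λ _ → false) ≡ 0
countFin-false {zero} = refl
countFin-false {suc m} = countFin-false {m}

countFin-true : countFin {m} (λ _ → true) ≡ m
countFin-true {zero} = refl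
countFin-true {suc m} = cong suc (countFin-true {m})

countFin-mono : {P Q : Fin m → Bool} → (∀ i → P i ≡ true → Q i ≡ true) → countFin P ≤ countFin Q
countFin-mono {zero} P⊆Q = z≤n
countFin-mono {suc m} {P} {Q} P⊆Q with P fzero in P0 | Q fzero in Q0
... | false | false = countFin-mono (P⊆Q ∘ fsuc)
... | false | true  = m≤n⇒m≤1+n (countFin-mono (P⊆Q ∘ fsuc))
... | true  | true  = s≤s (countFin-mono (P⊆Q ∘ fsuc))
... | true  | false with () ← trans (sym (P⊆Q fzero P0)) Q0

countFin-≤ : (P : Fin m → Bool) → countFin P ≤ m
countFin-≤ {m} P = ≤-trans (countFin-mono {m} {P} {λ _ → true} (λ _ _ → refl)) (≤-reflexive (countFin-true {m}))

countFin-< : {P : Fin m → Bool} (i : Fin m) → P i ≡ false → countFin P < m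
countFin-< {suc m} {P} fzero P0 rewrite P0 = s≤s (countFin-≤ (P ∘ fsuc))
countFin-< {suc m} {P} (fsuc i) Pi with P fzero
... | true  = s≤s (countFin-< i Pi)
... | false = m≤n⇒m≤1+n (countFin-< i Pi)

countFin-∨ : {P Q : Fin m → Bool} → (∀ i → P i ≡ true → Q i ≡ false) →
             countFin (λ i → P i ∨ Q i) ≡ countFin P + countFin Q
countFin-∨ {zero} disj = refl
countFin-∨ {suc m} {P} {Q} disj with P fzero in P0 | Q fzero in Q0
... | false | false = countFin-∨ (disj ∘ fsuc)
... | false | true  = trans (cong suc (countFin-∨ (disj ∘ fsuc))) (sym (+-suc _ _))
... | true  | false = cong suc (countFin-∨ (disj ∘ fsuc))
... | true  | true with () ← trans (sym (disj fzero P0)) Q0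

countFin≡0⇒none : {P : Fin m → Bool} → countFin P ≡ 0 → ∀ i → P i ≡ false
countFin≡0⇒none {suc m} {P} #P≡0 i with P fzero in P0
countFin≡0⇒none {suc m} {P} #P≡0 fzero    | false = P0
countFin≡0⇒none {suc m} {P} #P≡0 (fsuc i) | false = countFin≡0⇒none #P≡0 i

countFin≡m⇒all : {P : Fin m → Bool} → countFin P ≡ m → ∀ i → P i ≡ true
countFin≡m⇒all {P = P} #P≡m i with P i in Pi
... | true  = refl
... | false = contradiction #P≡m (<⇒≢ (countFin-< i Pi))

countFin-<ᵇ : ∀ {t} → t ≤ m → countFin {m} (λ i → toℕ i <ᵇ t) ≡ t
countFin-<ᵇ {m} {zero} _ = countFin-false {m}
countFin-<ᵇ {suc m} {suc t} (s≤s t≤m) = cong suc (countFin-<ᵇ t≤m)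

none⇒countFin≡0 : {P : Fin m → Bool} → (∀ i → P i ≡ false) → countFin P ≡ 0
none⇒countFin≡0 {m} none = trans (countFin-cong none) (countFin-false {m})

all⇒countFin≡m : {P : Fin m → Bool} → (∀ i → P i ≡ true) → countFin P ≡ m
all⇒countFin≡m {m} all = trans (countFin-cong all) (countFin-true {m})

VertexSet : ℕ → ℕ → Set
VertexSet n d = V n d → Bool

infixl 6 _∪_

∅ : VertexSet n d
∅ _ = false

_∪_ : VertexSet n d → VertexSet n d → VertexSet n d
(R ∪ S) x = R x ∨ S x

_⊆_ : VertexSet n d → VertexSet n d → Set
R ⊆ S = ∀ x → R x ≡ true → S x ≡ true

Disjoint : VertexSet n d → VertexSet n d → Set
Disjoint R S = ∀ x → R x ≡ true → S x ≡ false

_≟ᵥ_ : (x y : V n d) → Dec (x ≡ y)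
_≟ᵥ_ = ≡-dec Fin._≟_ Fin._≟_

single : V n d → VertexSet n d
single u y = ⌊ y ≟ᵥ u ⌋

cliqueCount indepCount : VertexSet n d → ℕ
cliqueCount R = countFin (λ i → R (inj₁ i))
indepCount R = countFin (λ j → R (inj₂ j))

∪-true⇔ : ∀ {R S : VertexSet n d} {x} → (R ∪ S) x ≡ true ⇔ (R x ≡ true ⊎ S x ≡ true)
∪-true⇔ {R = R} {S} {x} = mk⇔ to from
  where
  from : R x ≡ true ⊎ S x ≡ true → R x ∨ S x ≡ true
  from (inj₁ Rx) = cong (_∨ S x) Rx
  from (inj₂ Sx) = trans (cong (R x ∨_) Sx) (∨-zeroʳ (R x))
  to : R x ∨ S x ≡ true → R x ≡ true ⊎ S x ≡ true
  to e with R x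
  ... | true  = inj₁ refl
  ... | false = inj₂ e

AllUnstable : VertexSet n d → Config n d → Set
AllUnstable S c = ∀ x → S x ≡ true → deg x ≤ c x

neighboursIn : VertexSet n d → V n d → ℕ
neighboursIn R x = countV (λ y → R y ∧ adj y x)

neighboursIn-cong : {R R′ : VertexSet n d} → R ≗ R′ → ∀ x → neighboursIn R x ≡ neighboursIn R′ x
neighboursIn-cong R≗R′ x = cong₂ _+_ (countFin-cong (λ i → cong (_∧ _) (R≗R′ (inj₁ i))))
                                     (countFin-cong (λ j → cong (_∧ _) (R≗R′ (inj₂ j))))

neighboursIn-mono : {R R′ : VertexSet n d} → R ⊆ R′ → ∀ x → neighboursIn R x ≤ neighboursIn R′ x
neighboursIn-mono R⊆R′ x = +-mono-≤ (countFin-mono (λ i → ∧-⊆ (R⊆R′ (inj₁ i))))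
                                    (countFin-mono (λ j → ∧-⊆ (R⊆R′ (inj₂ j))))
  where
  ∧-⊆ : ∀ {a b c} → (a ≡ true → b ≡ true) → a ∧ c ≡ true → b ∧ c ≡ true
  ∧-⊆ {true} a⇒b e rewrite a⇒b refl = e

neighboursIn-∪ : {R S : VertexSet n d} → Disjoint R S → ∀ x →
                 neighboursIn (R ∪ S) x ≡ neighboursIn R x + neighboursIn S x
neighboursIn-∪ {n = n} {d = d} {R = R} {S} R∩S=∅ x = begin
  countFin (λ i → (R (inj₁ i) ∨ S (inj₁ i)) ∧ adj (inj₁ i) x) +
  countFin (λ j → (R (inj₂ j) ∨ S (inj₂ j)) ∧ adj (inj₂ j) x)
    ≡⟨ cong₂ _+_ (part inj₁) (part inj₂) ⟩
  (countFin (λ i → R (inj₁ i) ∧ adj (inj₁ i) x) + countFin (λ i → S (inj₁ i) ∧ adj (inj₁ i) x)) +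
  (countFin (λ j → R (inj₂ j) ∧ adj (inj₂ j) x) + countFin (λ j → S (inj₂ j) ∧ adj (inj₂ j) x))
    ≡⟨ interchange (countFin (λ i → R (inj₁ i) ∧ adj (inj₁ i) x)) _ _ _ ⟩
  neighboursIn R x + neighboursIn S x ∎
  where
  open ≡-Reasoning
  disj∧ : ∀ {a b c} → (a ≡ true → b ≡ false) → a ∧ c ≡ true → b ∧ c ≡ false
  disj∧ {true} a⇒¬b e rewrite a⇒¬b refl = refl
  part : ∀ {k} (ι : Fin k → V n d) →
         countFin (λ i → (R (ι i) ∨ S (ι i)) ∧ adj (ι i) x)
           ≡ countFin (λ i → R (ι i) ∧ adj (ι i) x) + countFin (λ i → S (ι i) ∧ adj (ι i) x)
  part ι = trans (countFin-cong (λ i → ∧-distribʳ-∨ (adj (ι i) x) (R (ι i)) (S (ι i))))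
                 (countFin-∨ (λ i → disj∧ (R∩S=∅ (ι i))))

neighboursIn-∅ : {S : VertexSet n d} → S ≗ ∅ → ∀ x → neighboursIn S x ≡ 0
neighboursIn-∅ S=∅ x = cong₂ _+_ {y = 0} {v = 0} (none⇒countFin≡0 (λ i → cong (_∧ _) (S=∅ (inj₁ i))))
                                 (none⇒countFin≡0 (λ j → cong (_∧ _) (S=∅ (inj₂ j))))

neighboursIn-indep : (S : VertexSet n d) → (∀ i → S (inj₁ i) ≡ false) → ∀ j → neighboursIn S (inj₂ j) ≡ 0
neighboursIn-indep S S∩clique=∅ j =
  cong₂ _+_ {y = 0} {v = 0} (none⇒countFin≡0 (λ i → cong (_∧ true) (S∩clique=∅ i)))
                            (none⇒countFin≡0 (λ j′ → ∧-zeroʳ (S (inj₂ j′))))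

neighboursIn-<deg : (R : VertexSet n d) → ∀ x → neighboursIn R x < deg x
neighboursIn-<deg R (inj₁ i) =
  +-mono-<-≤ (countFin-< i (trans (cong (λ b → R (inj₁ i) ∧ not b) (⌊⌋-yes (i Fin.≟ i) refl)) (∧-zeroʳ _)))
             (countFin-≤ _)
neighboursIn-<deg R (inj₂ j) =
  +-mono-≤-< (countFin-≤ _) (≤-reflexive (cong suc (none⇒countFin≡0 (λ j′ → ∧-zeroʳ (R (inj₂ j′))))))

-- A single ITC round

toppleSet-∅ : {S : VertexSet n d} (c : Config n d) → S ≗ ∅ → toppleSet S c ≗ c
toppleSet-∅ {S = S} c S=∅ x rewrite S=∅ x | neighboursIn-∅ S=∅ x = +-identityʳ (c x)

Qset-unstable : (c : Config n d) → AllUnstable (Qset c) c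
Qset-unstable c (inj₂ j) = dec-true⁻ (_ ≤? _)

Pset-unstable : (c : Config n d) → AllUnstable (Pset c) (afterQ c)
Pset-unstable c (inj₁ i) = dec-true⁻ (_ ≤? _)

qRound≡indepCount : (c : Config n d) → qRound c ≡ indepCount (Qset c)
qRound≡indepCount {n} c = cong (_+ indepCount (Qset c)) (countFin-false {n})

pRound≡cliqueCount : (c : Config n d) → pRound c ≡ cliqueCount (Pset c)
pRound≡cliqueCount {d = d} c = trans (cong (cliqueCount (Pset c) +_) (countFin-false {d})) (+-identityʳ _)

qRound≡0⇒Qset≡∅ : (c : Config n d) → qRound c ≡ 0 → Qset c ≗ ∅
qRound≡0⇒Qset≡∅ c q≡0 (inj₁ i) = refl
qRound≡0⇒Qset≡∅ c q≡0 (inj₂ j) = countFin≡0⇒none (trans (sym (qRound≡indepCount c)) q≡0) j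

pRound≡0⇒Pset≡∅ : (c : Config n d) → pRound c ≡ 0 → Pset c ≗ ∅
pRound≡0⇒Pset≡∅ c p≡0 (inj₁ i) = countFin≡0⇒none (trans (sym (pRound≡cliqueCount c)) p≡0) i
pRound≡0⇒Pset≡∅ c p≡0 (inj₂ j) = refl

afterQ-outside : (c : Config n d) → ∀ j → Qset c (inj₂ j) ≡ false → afterQ c (inj₂ j) ≡ c (inj₂ j)
afterQ-outside c j Qj rewrite Qj | neighboursIn-indep (Qset c) (λ _ → refl) j = +-identityʳ _

stable⇔emptyRound : (c : Config n d) → Stable c ⇔ (qRound c ≡ 0 × pRound c ≡ 0)
stable⇔emptyRound c = mk⇔ to from
  where
  to : Stable c → qRound c ≡ 0 × pRound c ≡ 0
  to stable = trans (qRound≡indepCount c) (none⇒countFin≡0 (λ j → Q=∅ (inj₂ j)))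
            , trans (pRound≡cliqueCount c)
                    (none⇒countFin≡0 (λ i → dec-false (_ ≤? _) (<⇒≱ (afterQ-stable (inj₁ i)))))
    where
    Q=∅ : ∀ x → Qset c x ≡ false
    Q=∅ (inj₁ i) = refl
    Q=∅ (inj₂ j) = dec-false (_ ≤? _) (<⇒≱ (stable (inj₂ j)))
    afterQ-stable : Stable (afterQ c)
    afterQ-stable x = subst (_< deg x) (sym (toppleSet-∅ c Q=∅ x)) (stable x)
  from : qRound c ≡ 0 × pRound c ≡ 0 → Stable c
  from (q≡0 , p≡0) (inj₁ i) = subst (_< deg (inj₁ i)) (toppleSet-∅ c (qRound≡0⇒Qset≡∅ c q≡0) (inj₁ i))
                                    (≰⇒> (dec-false⁻ (_ ≤? _) (pRound≡0⇒Pset≡∅ c p≡0 (inj₁ i))))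
  from (q≡0 , p≡0) (inj₂ j) = ≰⇒> (dec-false⁻ (_ ≤? _) (qRound≡0⇒Qset≡∅ c q≡0 (inj₂ j)))

unstable⇒round-pos : (c : Config n d) → ¬ Stable c → 0 < qRound c + pRound c
unstable⇒round-pos c unstable = n≢0⇒n>0 λ q+p≡0 →
  unstable (Equivalence.from (stable⇔emptyRound c) (m+n≡0⇒m≡0 (qRound c) q+p≡0 , m+n≡0⇒n≡0 (qRound c) q+p≡0))

-- The paper's conditions a₁, …, a_{k-1} > 0 and b_k + a_k > 0, read from the front.
data Admissible : List ℕ → List ℕ → Set where
  final : ∀ {q p} → 0 < q + p → Admissible (q ∷ []) (p ∷ [])
  _∷_   : ∀ {q p qs ps} → 0 < p → Admissible qs ps → Admissible (q ∷ qs) (p ∷ ps)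

SnocAdmissible : List ℕ → List ℕ → Set
SnocAdmissible qs ps = ∃[ qs′ ] ∃[ ps′ ] ∃[ q ] ∃[ p ]
  (qs ≡ qs′ ++ q ∷ [] × ps ≡ ps′ ++ p ∷ [] × length ps′ ≡ length qs′ × All (0 <_) ps′ × 0 < q + p)

admissible⇒snoc : ∀ {qs ps} → Admissible qs ps → SnocAdmissible qs ps
admissible⇒snoc (final pos) = [] , [] , _ , _ , refl , refl , refl , [] , pos
admissible⇒snoc (p>0 ∷ adm) with admissible⇒snoc adm
... | qs′ , ps′ , q , p , refl , refl , len , all , pos =
  _ ∷ qs′ , _ ∷ ps′ , q , p , refl , refl , cong suc len , p>0 ∷ all , pos

snoc⇒admissible : ∀ qs′ ps′ {q p} → length ps′ ≡ length qs′ → All (0 <_) ps′ → 0 < q + p →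
                  Admissible (qs′ ++ q ∷ []) (ps′ ++ p ∷ [])
snoc⇒admissible []         []         _   []           pos = final pos
snoc⇒admissible (_ ∷ qs′) (_ ∷ ps′) len (p>0 ∷ all) pos =
  p>0 ∷ snoc⇒admissible qs′ ps′ (suc-injective len) all pos

admissible-head : ∀ {q p qs ps} → Admissible (q ∷ qs) (p ∷ ps) → 0 < p ⊎ (qs ≡ [] × ps ≡ [])
admissible-head (final _) = inj₂ (refl , refl)
admissible-head (p>0 ∷ _) = inj₁ p>0

admissible-head-pos : ∀ {q p qs ps} → Admissible (q ∷ qs) (p ∷ ps) → 0 < q + p
admissible-head-pos (final q+p>0) = q+p>0
admissible-head-pos {q} {p} (p>0 ∷ _) = ≤-trans p>0 (m≤n+m p q)

run-unstable : ∀ {c : Config n d} {qs ps} → ITCFrom c qs ps → Admissible qs ps → ¬ Stable c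
run-unstable {c = c} r adm stable with Equivalence.to (stable⇔emptyRound c) stable
... | q≡0 , p≡0 = <⇒≢ (first-round-pos r adm) (sym (cong₂ _+_ q≡0 p≡0))
  where
  first-round-pos : ∀ {qs ps} → ITCFrom c qs ps → Admissible qs ps → 0 < qRound c + pRound c
  first-round-pos (stop _)   adm = admissible-head-pos adm
  first-round-pos (more _ _) adm = admissible-head-pos adm

-- Toppling every vertex at most once

vertices : List (V n d)
vertices {n} {d} = map (splitAt n) (allFin (n + d))

∈-vertices : (x : V n d) → x ∈ vertices
∈-vertices {n} {d} x = subst (_∈ vertices) (Fin.splitAt-join n d x) (∈-map⁺ (splitAt n) (∈-allFin (join n d x)))

vertices-unique : Unique (vertices {n} {d})
vertices-unique {n} {d} = Unique.map⁺ splitAt-injective (Unique.allFin⁺ (n + d))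
  where
  splitAt-injective : ∀ {i j} → splitAt n i ≡ splitAt n j → i ≡ j
  splitAt-injective {i} {j} eq = trans (sym (Fin.join-splitAt n d i)) (trans (cong (join n d) eq) (Fin.join-splitAt n d j))

enum : VertexSet n d → List (V n d)
enum S = filter (λ x → S x Bool.≟ true) vertices

∈-enum⇔ : ∀ {S : VertexSet n d} {x} → x ∈ enum S ⇔ S x ≡ true
∈-enum⇔ {S = S} {x} = mk⇔ (proj₂ ∘ ∈-filter⁻ (λ y → S y Bool.≟ true) {xs = vertices})
                          (∈-filter⁺ (λ y → S y Bool.≟ true) (∈-vertices x))

enum-unique : (S : VertexSet n d) → Unique (enum S)
enum-unique S = Unique.filter⁺ (λ y → S y Bool.≟ true) vertices-unique

∪-enum⇔ : ∀ {R S : VertexSet n d} {x} → (R ∪ S) x ≡ true ⇔ (R x ≡ true ⊎ x ∈ enum S)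
∪-enum⇔ {R = R} {S} {x} =
  mk⇔ (map₂ (Equivalence.from (∈-enum⇔ {S = S})) ∘ Equivalence.to (∪-true⇔ {R = R} {S} {x}))
      (Equivalence.from (∪-true⇔ {R = R} {S} {x}) ∘ map₂ (Equivalence.to (∈-enum⇔ {S = S})))

phase-unique : ∀ {S : VertexSet n d} {rest} → Unique rest → (∀ x → x ∈ rest → S x ≡ false) →
               Unique (enum S ++ rest)
phase-unique {S = S} uniq S∩rest=∅ = Unique.++⁺ (enum-unique S) uniq
  (λ (x∈S , x∈rest) → contradiction (trans (sym (Equivalence.to ∈-enum⇔ x∈S)) (S∩rest=∅ _ x∈rest)) λ ())

roundOrder : Config n d → List (V n d) → List (V n d)
roundOrder c rest = enum (Qset c) ++ enum (Pset c) ++ rest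

toppledAfter : ∀ {c : Config n d} {qs ps} → VertexSet n d → ITCFrom c qs ps → VertexSet n d
toppledAfter {c = c} R (stop _)   = R ∪ Qset c ∪ Pset c
toppledAfter {c = c} R (more _ r) = toppledAfter (R ∪ Qset c ∪ Pset c) r

order : ∀ {c : Config n d} {qs ps} → ITCFrom c qs ps → List (V n d)
order {c = c} (stop _)   = roundOrder c []
order {c = c} (more _ r) = roundOrder c (order r)

roundOrder-complete : ∀ {c : Config n d} {R rest x} → (R ∪ Qset c ∪ Pset c) x ≡ true ⊎ x ∈ rest →
                      R x ≡ true ⊎ x ∈ roundOrder c rest
roundOrder-complete {c = c} {R} (inj₁ e) with Equivalence.to (∪-enum⇔ {R = R ∪ Qset c}) e
... | inj₂ x∈P = inj₂ (∈-++⁺ʳ (enum (Qset c)) (∈-++⁺ˡ x∈P))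
... | inj₁ e′ with Equivalence.to (∪-enum⇔ {R = R}) e′
...   | inj₁ Rx  = inj₁ Rx
...   | inj₂ x∈Q = inj₂ (∈-++⁺ˡ x∈Q)
roundOrder-complete {c = c} (inj₂ x∈rest) = inj₂ (∈-++⁺ʳ (enum (Qset c)) (∈-++⁺ʳ (enum (Pset c)) x∈rest))

order-complete : ∀ {c : Config n d} {qs ps R x} (r : ITCFrom c qs ps) →
                 toppledAfter R r x ≡ true → R x ≡ true ⊎ x ∈ order r
order-complete {R = R} (stop _)   e = roundOrder-complete {R = R} (inj₁ e)
order-complete {R = R} (more _ r) e = roundOrder-complete {R = R} (order-complete r e)

toppleSet-cong : ∀ {c c′ : Config n d} (S : VertexSet n d) → c ≗ c′ → toppleSet S c ≗ toppleSet S c′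
toppleSet-cong S c≗c′ x = cong (λ m → (m ∸ (if S x then deg x else 0)) + neighboursIn S x) (c≗c′ x)

ValidSeq-cong : ∀ {c c′ : Config n d} {us} → c ≗ c′ → ValidSeq c us → ValidSeq c′ us
ValidSeq-cong {us = []}     c≗c′ _ = _
ValidSeq-cong {us = u ∷ us} c≗c′ (unstable , valid) =
  subst (deg u ≤_) (c≗c′ u) unstable , ValidSeq-cong (toppleSet-cong (single u) c≗c′) valid

module Toppling {n d : ℕ} (c0 : Config n d) where

  private
    variable
      R R′ S U : VertexSet n d
      c c′ f : Config n d

  -- c arises from c0 by toppling the sink and then every vertex of R once; the balance is
  -- stated additively, so no truncated subtraction occurs.
  record Toppled (R : VertexSet n d) (c : Config n d) : Set where
    constructor mkToppled
    field
      balance : ∀ x → c x + (if R x then deg x else 0) ≡ suc (c0 x) + neighboursIn R x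

  open Toppled

  toppleSink-toppled : Toppled ∅ (toppleSink c0)
  toppleSink-toppled = mkToppled (λ x → cong (suc (c0 x) +_) (sym (neighboursIn-∅ (λ _ → refl) x)))

  Toppled-cong : R ≗ R′ → Toppled R c → Toppled R′ c
  Toppled-cong {c = c} R≗R′ t = mkToppled λ x →
    trans (cong (λ b → c x + (if b then deg x else 0)) (sym (R≗R′ x)))
          (trans (balance t x) (cong (suc (c0 x) +_) (neighboursIn-cong R≗R′ x)))

  Toppled-unique : Toppled R c → Toppled R c′ → c ≗ c′
  Toppled-unique t t′ x = +-cancelʳ-≡ _ _ _ (trans (balance t x) (sym (balance t′ x)))

  toppled-outside : Toppled R c → ∀ {x} → R x ≡ false → c x ≡ suc (c0 x) + neighboursIn R x
  toppled-outside {R} {c} t {x} Rx = begin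
    c x                                  ≡⟨ sym (+-identityʳ (c x)) ⟩
    c x + 0                              ≡⟨ cong (λ b → c x + (if b then deg x else 0)) (sym Rx) ⟩
    c x + (if R x then deg x else 0)     ≡⟨ balance t x ⟩
    suc (c0 x) + neighboursIn R x        ∎
    where open ≡-Reasoning

  toppled-≤ : Toppled R c → Toppled U f → R ⊆ U → ∀ {x} → U x ≡ false → c x ≤ f x
  toppled-≤ {R} {c} {U} {f} t u R⊆U {x} Ux = begin
    c x                               ≤⟨ m≤m+n (c x) _ ⟩
    c x + (if R x then deg x else 0)  ≡⟨ balance t x ⟩
    suc (c0 x) + neighboursIn R x     ≤⟨ +-monoʳ-≤ (suc (c0 x)) (neighboursIn-mono R⊆U x) ⟩
    suc (c0 x) + neighboursIn U x     ≡⟨ sym (toppled-outside u Ux) ⟩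
    f x                               ∎
    where open ≤-Reasoning

  module FromStable (c0-stable : Stable c0) where

    toppled-stable : Toppled R c → ∀ {x} → R x ≡ true → c x < deg x
    toppled-stable {R} {c} t {x} Rx = +-cancelʳ-< (deg x) (c x) (deg x) (begin-strict
      c x + deg x                       ≡⟨ cong (λ b → c x + (if b then deg x else 0)) (sym Rx) ⟩
      c x + (if R x then deg x else 0)  ≡⟨ balance t x ⟩
      suc (c0 x) + neighboursIn R x     <⟨ +-mono-≤-< (c0-stable x) (neighboursIn-<deg R x) ⟩
      deg x + deg x                     ∎)
      where open ≤-Reasoning

    unstable-outside : Toppled R c → ∀ {x} → deg x ≤ c x → R x ≡ false
    unstable-outside {R} t {x} unstable with R x in Rx
    ... | true  = contradiction unstable (<⇒≱ (toppled-stable t Rx))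
    ... | false = refl

    unstable-disjoint : Toppled R c → AllUnstable S c → Disjoint R S
    unstable-disjoint {S = S} t S-unstable x Rx with S x in Sx
    ... | true with () ← trans (sym Rx) (unstable-outside t (S-unstable x Sx))
    ... | false = refl

    toppleSet-toppled : Toppled R c → AllUnstable S c → Toppled (R ∪ S) (toppleSet S c)
    toppleSet-toppled {R} {c} {S} t S-unstable = mkToppled balance′
      where
      merge : ∀ x → suc (c0 x) + neighboursIn R x + neighboursIn S x ≡ suc (c0 x) + neighboursIn (R ∪ S) x
      merge x = trans (+-assoc (suc (c0 x)) _ _)
                      (cong (suc (c0 x) +_) (sym (neighboursIn-∪ (unstable-disjoint t S-unstable) x)))
      balance′ : ∀ x → toppleSet S c x + (if (R ∪ S) x then deg x else 0) ≡ suc (c0 x) + neighboursIn (R ∪ S) x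
      balance′ x with S x in Sx
      ... | true = begin
        (c x ∸ deg x) + neighboursIn S x + (if R x ∨ true then deg x else 0)
          ≡⟨ cong (λ b → (c x ∸ deg x) + neighboursIn S x + (if b ∨ true then deg x else 0)) Rx ⟩
        (c x ∸ deg x) + neighboursIn S x + deg x          ≡⟨ xy∙z≈xz∙y (c x ∸ deg x) _ _ ⟩
        (c x ∸ deg x) + deg x + neighboursIn S x          ≡⟨ cong (_+ _) (m∸n+n≡m (S-unstable x Sx)) ⟩
        c x + neighboursIn S x                            ≡⟨ cong (_+ _) (toppled-outside t Rx) ⟩
        suc (c0 x) + neighboursIn R x + neighboursIn S x  ≡⟨ merge x ⟩
        suc (c0 x) + neighboursIn (R ∪ S) x               ∎
        where
        open ≡-Reasoning
        Rx : R x ≡ false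
        Rx = unstable-outside t (S-unstable x Sx)
      ... | false = begin
        c x + neighboursIn S x + (if R x ∨ false then deg x else 0)
          ≡⟨ cong (λ b → c x + neighboursIn S x + (if b then deg x else 0)) (∨-identityʳ (R x)) ⟩
        c x + neighboursIn S x + (if R x then deg x else 0)  ≡⟨ xy∙z≈xz∙y (c x) _ _ ⟩
        c x + (if R x then deg x else 0) + neighboursIn S x  ≡⟨ cong (_+ neighboursIn S x) (balance t x) ⟩
        suc (c0 x) + neighboursIn R x + neighboursIn S x     ≡⟨ merge x ⟩
        suc (c0 x) + neighboursIn (R ∪ S) x                  ∎
        where open ≡-Reasoning

    afterQ-toppled : Toppled R c → Toppled (R ∪ Qset c) (afterQ c)
    afterQ-toppled {c = c} t = toppleSet-toppled t (Qset-unstable c)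

    afterRound-toppled : Toppled R c → Toppled (R ∪ Qset c ∪ Pset c) (afterRound c)
    afterRound-toppled {c = c} t = toppleSet-toppled (afterQ-toppled t) (Pset-unstable c)

    round-indepCount : Toppled R c → indepCount (R ∪ Qset c ∪ Pset c) ≡ indepCount R + qRound c
    round-indepCount {R} {c} t = begin
      indepCount (R ∪ Qset c ∪ Pset c)
        ≡⟨ countFin-cong (λ j → ∨-identityʳ (R (inj₂ j) ∨ Qset c (inj₂ j))) ⟩
      indepCount (R ∪ Qset c)
        ≡⟨ countFin-∨ (λ j → unstable-disjoint t (Qset-unstable c) (inj₂ j)) ⟩
      indepCount R + indepCount (Qset c)  ≡⟨ cong (indepCount R +_) (sym (qRound≡indepCount c)) ⟩
      indepCount R + qRound c             ∎
      where open ≡-Reasoning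

    round-cliqueCount : Toppled R c → cliqueCount (R ∪ Qset c ∪ Pset c) ≡ cliqueCount R + pRound c
    round-cliqueCount {R} {c} t = begin
      cliqueCount (R ∪ Qset c ∪ Pset c)
        ≡⟨ countFin-∨ (λ i → unstable-disjoint (afterQ-toppled t) (Pset-unstable c) (inj₁ i)) ⟩
      cliqueCount (R ∪ Qset c) + cliqueCount (Pset c)
        ≡⟨ cong₂ _+_ (countFin-cong (λ i → ∨-identityʳ (R (inj₁ i)))) (sym (pRound≡cliqueCount c)) ⟩
      cliqueCount R + pRound c                  ∎
      where open ≡-Reasoning

    pRound≡0⇒stable : Toppled R c → pRound c ≡ 0 → Stable (afterRound c)
    pRound≡0⇒stable {R} {c} t p≡0 x =
      subst (_< deg x) (sym (toppleSet-∅ (afterQ c) (pRound≡0⇒Pset≡∅ c p≡0) x)) (afterQ-stable x)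
      where
      afterQ-stable : Stable (afterQ c)
      afterQ-stable (inj₁ i) = ≰⇒> (dec-false⁻ (_ ≤? _) (pRound≡0⇒Pset≡∅ c p≡0 (inj₁ i)))
      afterQ-stable (inj₂ j) with Qset c (inj₂ j) Bool.≟ true
      ... | yes Qj = toppled-stable (afterQ-toppled t) {inj₂ j} (Equivalence.from (∪-true⇔ {R = R} {S = Qset c}) (inj₂ Qj))
      ... | no ¬Qj = subst (_< n + 1) (sym (afterQ-outside c j (¬-not ¬Qj))) (≰⇒> (dec-false⁻ (_ ≤? _) (¬-not ¬Qj)))

    more⇒pRound-pos : Toppled R c → ¬ Stable (afterRound c) → 0 < pRound c
    more⇒pRound-pos t unstable = n≢0⇒n>0 (unstable ∘ pRound≡0⇒stable t)

    run-admissible : ∀ {qs ps} → Toppled R c → ITCFrom c qs ps → ¬ Stable c → Admissible qs ps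
    run-admissible {c = c} t (stop _) unstable = final (unstable⇒round-pos c unstable)
    run-admissible t (more unstable′ r) _ =
      more⇒pRound-pos t unstable′ ∷ run-admissible (afterRound-toppled t) r unstable′

    run-final : ∀ {qs ps} → Toppled R c → (r : ITCFrom c qs ps) → ∃[ f ] (Stable f × Toppled (toppledAfter R r) f)
    run-final {c = c} t (stop stable) = afterRound c , stable , afterRound-toppled t
    run-final t (more _ r) = run-final (afterRound-toppled t) r

    run-indepCount : ∀ {qs ps} → Toppled R c → (r : ITCFrom c qs ps) →
                     indepCount (toppledAfter R r) ≡ indepCount R + sum qs
    run-indepCount {R} {c} t (stop _) = trans (round-indepCount t) (cong (indepCount R +_) (sym (+-identityʳ (qRound c))))
    run-indepCount {R} {c} t (more {qs} _ r) = begin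
      indepCount (toppledAfter (R ∪ Qset c ∪ Pset c) r)   ≡⟨ run-indepCount (afterRound-toppled t) r ⟩
      indepCount (R ∪ Qset c ∪ Pset c) + sum qs         ≡⟨ cong (_+ sum qs) (round-indepCount t) ⟩
      indepCount R + qRound c + sum qs                  ≡⟨ +-assoc (indepCount R) _ _ ⟩
      indepCount R + (qRound c + sum qs)                ∎
      where open ≡-Reasoning

    run-cliqueCount : ∀ {qs ps} → Toppled R c → (r : ITCFrom c qs ps) →
                      cliqueCount (toppledAfter R r) ≡ cliqueCount R + sum ps
    run-cliqueCount {R} {c} t (stop _) = trans (round-cliqueCount t) (cong (cliqueCount R +_) (sym (+-identityʳ (pRound c))))
    run-cliqueCount {R} {c} t (more {ps = ps} _ r) = begin
      cliqueCount (toppledAfter (R ∪ Qset c ∪ Pset c) r)  ≡⟨ run-cliqueCount (afterRound-toppled t) r ⟩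
      cliqueCount (R ∪ Qset c ∪ Pset c) + sum ps        ≡⟨ cong (_+ sum ps) (round-cliqueCount t) ⟩
      cliqueCount R + pRound c + sum ps                 ≡⟨ +-assoc (cliqueCount R) _ _ ⟩
      cliqueCount R + (pRound c + sum ps)               ∎
      where open ≡-Reasoning

    toppleOne-toppled : ∀ {u} → Toppled R c → deg u ≤ c u → Toppled (R ∪ single u) (toppleOne u c)
    toppleOne-toppled {c = c} {u} t unstable =
      toppleSet-toppled {S = single u} t
        (λ y y≡u → subst (λ z → deg z ≤ c z) (sym (⌊⌋-yes⁻ (y ≟ᵥ u) y≡u)) unstable)

    -- Least action: a legal sequence never topples outside a set whose toppling stabilises.
    validSeq-⊆ : ∀ {us} → Toppled R c → R ⊆ U → Toppled U f → Stable f → ValidSeq c us →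
                 ∀ x → x ∈ us → U x ≡ true
    validSeq-⊆ {R} {c} {U} {f} {u ∷ us} t R⊆U u-t f-stable (unstable , valid) x x∈us = go x∈us
      where
      Uu : U u ≡ true
      Uu with U u Bool.≟ true
      ... | yes Uu = Uu
      ... | no ¬Uu = contradiction (≤-trans unstable (toppled-≤ t u-t R⊆U (¬-not ¬Uu))) (<⇒≱ (f-stable u))
      R∪u⊆U : (R ∪ single u) ⊆ U
      R∪u⊆U y e with Equivalence.to (∪-true⇔ {R = R} {S = single u}) e
      ... | inj₁ Ry   = R⊆U y Ry
      ... | inj₂ y≡u = subst (λ z → U z ≡ true) (sym (⌊⌋-yes⁻ (y ≟ᵥ u) y≡u)) Uu
      go : x ∈ u ∷ us → U x ≡ true
      go (here refl)   = Uu
      go (there x∈us′) = validSeq-⊆ (toppleOne-toppled t unstable) R∪u⊆U u-t f-stable valid x x∈us′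

    toppleEach : ∀ {L rest} → Toppled R c → Unique L → (∀ x → x ∈ L → deg x ≤ c x) →
                 (R′ : VertexSet n d) → (∀ x → R′ x ≡ true ⇔ (R x ≡ true ⊎ x ∈ L)) →
                 (∀ c′ → Toppled R′ c′ → ValidSeq c′ rest) → ValidSeq c (L ++ rest)
    toppleEach {R} {c} {[]} t _ _ R′ R′⇔ k = k c (Toppled-cong (λ x → ≡true⇔⇒≡ (R≡R′ x)) t)
      where
      R≡R′ : ∀ x → R x ≡ true ⇔ R′ x ≡ true
      R≡R′ x = mk⇔ (Equivalence.from (R′⇔ x) ∘ inj₁) ([ id , (λ ()) ] ∘ Equivalence.to (R′⇔ x))
    toppleEach {R} {c} {u ∷ L} t (u∉L ∷ uniq) unstable R′ R′⇔ k =
      unstable u (here refl) , toppleEach t-u uniq unstable′ R′ R′⇔′ k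
      where
      t-u : Toppled (R ∪ single u) (toppleOne u c)
      t-u = toppleOne-toppled t (unstable u (here refl))
      unstable′ : ∀ x → x ∈ L → deg x ≤ toppleOne u c x
      unstable′ x x∈L = ≤-trans (unstable x (there x∈L))
        (toppled-≤ t t-u (λ y Ry → cong (_∨ single u y) Ry)
          (cong₂ _∨_ (unstable-outside t (unstable x (there x∈L)))
                     (⌊⌋-no (x ≟ᵥ u) (λ x≡u → lookup u∉L x∈L (sym x≡u)))))
      R′⇔′ : ∀ x → R′ x ≡ true ⇔ ((R ∪ single u) x ≡ true ⊎ x ∈ L)
      R′⇔′ x = mk⇔ to from
        where
        to : R′ x ≡ true → (R ∪ single u) x ≡ true ⊎ x ∈ L
        to e with Equivalence.to (R′⇔ x) e
        ... | inj₁ Rx           = inj₁ (cong (_∨ single u x) Rx)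
        ... | inj₂ (here refl)  =
          inj₁ (Equivalence.from (∪-true⇔ {R = R} {S = single u}) (inj₂ (⌊⌋-yes (x ≟ᵥ x) refl)))
        ... | inj₂ (there x∈L)  = inj₂ x∈L
        from : (R ∪ single u) x ≡ true ⊎ x ∈ L → R′ x ≡ true
        from (inj₁ e) with Equivalence.to (∪-true⇔ {R = R} {S = single u}) e
        ... | inj₁ Rx  = Equivalence.from (R′⇔ x) (inj₁ Rx)
        ... | inj₂ x≡u = Equivalence.from (R′⇔ x) (inj₂ (here (⌊⌋-yes⁻ (x ≟ᵥ u) x≡u)))
        from (inj₂ x∈L) = Equivalence.from (R′⇔ x) (inj₂ (there x∈L))

    phase-valid : ∀ {rest} → Toppled R c → AllUnstable S c →
                  (∀ c′ → Toppled (R ∪ S) c′ → ValidSeq c′ rest) → ValidSeq c (enum S ++ rest)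
    phase-valid {R} {S = S} t S-unstable =
      toppleEach t (enum-unique S) (λ x x∈S → S-unstable x (Equivalence.to ∈-enum⇔ x∈S))
                 (R ∪ S) (λ x → ∪-enum⇔ {R = R})

    phase-fresh : ∀ {rest} → Toppled R c → AllUnstable S c →
                  (∀ x → x ∈ rest → (R ∪ S) x ≡ false) → ∀ x → x ∈ enum S ++ rest → R x ≡ false
    phase-fresh {R} {S = S} t S-unstable fresh x x∈S++rest with ∈-++⁻ (enum S) x∈S++rest
    ... | inj₁ x∈S    = unstable-outside t (S-unstable x (Equivalence.to ∈-enum⇔ x∈S))
    ... | inj₂ x∈rest = ∨-conicalˡ (R x) (S x) (fresh x x∈rest)

    roundOrder-valid : ∀ {rest} → Toppled R c →
                       (∀ c′ → Toppled (R ∪ Qset c ∪ Pset c) c′ → ValidSeq c′ rest) →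
                       ValidSeq c (roundOrder c rest)
    roundOrder-valid {c = c} t k = phase-valid t (Qset-unstable c) λ c′ t′ →
      phase-valid t′ (λ x Px → subst (deg x ≤_) (Toppled-unique (afterQ-toppled t) t′ x) (Pset-unstable c x Px)) k

    roundOrder-fresh : ∀ {rest} → Toppled R c → (∀ x → x ∈ rest → (R ∪ Qset c ∪ Pset c) x ≡ false) →
                       ∀ x → x ∈ roundOrder c rest → R x ≡ false
    roundOrder-fresh {c = c} t fresh = phase-fresh t (Qset-unstable c) (phase-fresh (afterQ-toppled t) (Pset-unstable c) fresh)

    roundOrder-unique : ∀ {rest} → Toppled R c → Unique rest →
                        (∀ x → x ∈ rest → (R ∪ Qset c ∪ Pset c) x ≡ false) → Unique (roundOrder c rest)
    roundOrder-unique {R} {c} t uniq fresh =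
      phase-unique (phase-unique uniq (λ x → ∨-conicalʳ (R x ∨ Qset c x) _ ∘ fresh x))
                   (λ x → ∨-conicalʳ (R x) _ ∘ phase-fresh (afterQ-toppled t) (Pset-unstable c) fresh x)

    order-valid : ∀ {qs ps} → Toppled R c → (r : ITCFrom c qs ps) → ValidSeq c (order r)
    order-valid t (stop _)   = roundOrder-valid t (λ _ _ → _)
    order-valid t (more _ r) = roundOrder-valid t λ c′ t′ →
      ValidSeq-cong (Toppled-unique (afterRound-toppled t) t′) (order-valid (afterRound-toppled t) r)

    order-fresh : ∀ {qs ps} → Toppled R c → (r : ITCFrom c qs ps) → ∀ x → x ∈ order r → R x ≡ false
    order-fresh t (stop _)   = roundOrder-fresh t (λ _ ())
    order-fresh t (more _ r) = roundOrder-fresh t (order-fresh (afterRound-toppled t) r)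

    order-unique : ∀ {qs ps} → Toppled R c → (r : ITCFrom c qs ps) → Unique (order r)
    order-unique t (stop _)   = roundOrder-unique t [] (λ _ ())
    order-unique t (more _ r) = roundOrder-unique t (order-unique (afterRound-toppled t) r) (order-fresh (afterRound-toppled t) r)

    sink-run-indepCount : ∀ {qs ps} (r : ITCFrom (toppleSink c0) qs ps) → indepCount (toppledAfter ∅ r) ≡ sum qs
    sink-run-indepCount {qs} r = trans (run-indepCount toppleSink-toppled r) (cong (_+ sum qs) (countFin-false {d}))

    sink-run-cliqueCount : ∀ {qs ps} (r : ITCFrom (toppleSink c0) qs ps) → cliqueCount (toppledAfter ∅ r) ≡ sum ps
    sink-run-cliqueCount {ps = ps} r = trans (run-cliqueCount toppleSink-toppled r) (cong (_+ sum ps) (countFin-false {n}))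

-- Recurrence and the ITC sequence

recurrent⇒itc-sums : ∀ {c0 : Config n d} {qs ps} → Recurrent c0 → ITCFrom (toppleSink c0) qs ps →
                     sum qs ≡ d × sum ps ≡ n
recurrent⇒itc-sums {c0 = c0} (stable , _ , _ , covers , valid) r =
  trans (sym (sink-run-indepCount r)) (all⇒countFin≡m (everything ∘ inj₂)) ,
  trans (sym (sink-run-cliqueCount r)) (all⇒countFin≡m (everything ∘ inj₁))
  where
  open Toppling c0
  open Toppling.FromStable c0 stable
  everything : ∀ x → toppledAfter ∅ r x ≡ true
  everything x with run-final toppleSink-toppled r
  ... | f , f-stable , f-toppled = validSeq-⊆ toppleSink-toppled (λ _ ()) f-toppled f-stable valid x (covers x)

itc-sums⇒recurrent : ∀ {c0 : Config n d} {qs ps} → Stable c0 → ITCFrom (toppleSink c0) qs ps →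
                     sum qs ≡ d → sum ps ≡ n → Recurrent c0
itc-sums⇒recurrent {c0 = c0} stable r Σqs≡d Σps≡n =
  stable , order r , order-unique toppleSink-toppled r , covers , order-valid toppleSink-toppled r
  where
  open Toppling c0
  open Toppling.FromStable c0 stable
  everything : ∀ x → toppledAfter ∅ r x ≡ true
  everything (inj₁ i) = countFin≡m⇒all (trans (sink-run-cliqueCount r) Σps≡n) i
  everything (inj₂ j) = countFin≡m⇒all (trans (sink-run-indepCount r) Σqs≡d) j
  covers : ∀ x → x ∈ order r
  covers x = [ (λ ()) , id ] (order-complete r (everything x))

-- Realising an admissible sequence

m≤o<m+n⇒0<n : ∀ {m n o} → m ≤ o → o < m + n → 0 < n
m≤o<m+n⇒0<n {m} m≤o o<m+n = +-cancelˡ-< m 0 _ (≤-<-trans (≤-trans (≤-reflexive (+-identityʳ m)) m≤o) o<m+n)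

extend⇔ : ∀ {k β b} {U : Set} → (β ≤ k → (U ⇔ k < β + b)) → (k < β ⊎ U) ⇔ k < β + b
extend⇔ {k} {β} {b} U⇔ = mk⇔ to from
  where
  to : k < β ⊎ _ → k < β + b
  to (inj₁ k<β) = <-≤-trans k<β (m≤m+n β b)
  to (inj₂ u) with k <? β
  ... | yes k<β = <-≤-trans k<β (m≤m+n β b)
  ... | no  k≮β = Equivalence.to (U⇔ (≮⇒≥ k≮β)) u
  from : k < β + b → k < β ⊎ _
  from k<β+b with k <? β
  ... | yes k<β = inj₁ k<β
  ... | no  k≮β = inj₂ (Equivalence.from (U⇔ (≮⇒≥ k≮β)) k<β+b)

≤-∸-+⇔ : ∀ {e N s} → e ≤ N → (N ≤ (N ∸ e) + s ⇔ e ≤ s)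
≤-∸-+⇔ {e} {N} {s} e≤N = mk⇔
  (λ N≤ → +-cancelˡ-≤ (N ∸ e) e s (≤-trans (≤-reflexive (m∸n+n≡m e≤N)) N≤))
  (λ e≤s → ≤-trans (≤-reflexive (sym (m∸n+n≡m e≤N))) (+-monoʳ-≤ (N ∸ e) e≤s))

-- With the independent blocks B and clique blocks A scheduled alternately after β independent
-- and α clique vertices, the number of neighbours of independent vertex j (clique vertex i)
-- scheduled before it.
earlierᴵ earlierᶜ : ℕ → ℕ → List ℕ → List ℕ → ℕ → ℕ
earlierᴵ β α (b ∷ B) (a ∷ A) j = if j <ᵇ β + b then α else earlierᴵ (β + b) (α + a) B A j
earlierᴵ β α _       _       j = α
earlierᶜ β α (b ∷ B) (a ∷ A) i = if i <ᵇ α + a then β + b + α else earlierᶜ (β + b) (α + a) B A i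
earlierᶜ β α _       _       i = β + α

module _ (β α b a : ℕ) (B A : List ℕ) where

  earlierᴵ-here : ∀ {j} → j < β + b → earlierᴵ β α (b ∷ B) (a ∷ A) j ≡ α
  earlierᴵ-here j<β+b rewrite <ᵇ-true j<β+b = refl

  earlierᴵ-later : ∀ {j} → β + b ≤ j → earlierᴵ β α (b ∷ B) (a ∷ A) j ≡ earlierᴵ (β + b) (α + a) B A j
  earlierᴵ-later β+b≤j rewrite <ᵇ-false β+b≤j = refl

  earlierᶜ-here : ∀ {i} → i < α + a → earlierᶜ β α (b ∷ B) (a ∷ A) i ≡ β + b + α
  earlierᶜ-here i<α+a rewrite <ᵇ-true i<α+a = refl

  earlierᶜ-later : ∀ {i} → α + a ≤ i → earlierᶜ β α (b ∷ B) (a ∷ A) i ≡ earlierᶜ (β + b) (α + a) B A i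
  earlierᶜ-later α+a≤i rewrite <ᵇ-false α+a≤i = refl

earlierᴵ-≥ : ∀ β α B A j → α ≤ earlierᴵ β α B A j
earlierᴵ-≥ β α (b ∷ B) (a ∷ A) j with j <? β + b
... | yes j<β+b = ≤-reflexive (sym (earlierᴵ-here β α b a B A j<β+b))
... | no  j≮β+b = ≤-trans (m≤m+n α a)
                    (≤-trans (earlierᴵ-≥ (β + b) (α + a) B A j)
                             (≤-reflexive (sym (earlierᴵ-later β α b a B A (≮⇒≥ j≮β+b)))))
earlierᴵ-≥ β α []      _       j = ≤-refl
earlierᴵ-≥ β α (_ ∷ _) []      j = ≤-refl

earlierᴵ-≤ : ∀ β α B A j → earlierᴵ β α B A j ≤ α + sum A
earlierᴵ-≤ β α (b ∷ B) (a ∷ A) j with j <? β + b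
... | yes j<β+b = ≤-trans (≤-reflexive (earlierᴵ-here β α b a B A j<β+b)) (m≤m+n α _)
... | no  j≮β+b = ≤-trans (≤-reflexive (earlierᴵ-later β α b a B A (≮⇒≥ j≮β+b)))
                    (≤-trans (earlierᴵ-≤ (β + b) (α + a) B A j) (≤-reflexive (+-assoc α a (sum A))))
earlierᴵ-≤ β α []      _       j = m≤m+n α _
earlierᴵ-≤ β α (_ ∷ _) []      j = m≤m+n α 0

earlierᴵ-mono : ∀ β α B A {j j′} → j ≤ j′ → earlierᴵ β α B A j ≤ earlierᴵ β α B A j′
earlierᴵ-mono β α (b ∷ B) (a ∷ A) {j} {j′} j≤j′ with j <? β + b
... | yes j<β+b = ≤-trans (≤-reflexive (earlierᴵ-here β α b a B A j<β+b)) (earlierᴵ-≥ β α (b ∷ B) (a ∷ A) j′)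
... | no  j≮β+b = begin
  earlierᴵ β α (b ∷ B) (a ∷ A) j     ≡⟨ earlierᴵ-later β α b a B A (≮⇒≥ j≮β+b) ⟩
  earlierᴵ (β + b) (α + a) B A j     ≤⟨ earlierᴵ-mono (β + b) (α + a) B A j≤j′ ⟩
  earlierᴵ (β + b) (α + a) B A j′    ≡⟨ earlierᴵ-later β α b a B A (≤-trans (≮⇒≥ j≮β+b) j≤j′) ⟨
  earlierᴵ β α (b ∷ B) (a ∷ A) j′    ∎
  where open ≤-Reasoning
earlierᴵ-mono β α []      _       _ = ≤-refl
earlierᴵ-mono β α (_ ∷ _) []      _ = ≤-refl

earlierᶜ-≥ : ∀ β α B A i → β + α ≤ earlierᶜ β α B A i
earlierᶜ-cons-≥ : ∀ β α b a B A i → β + b + α ≤ earlierᶜ β α (b ∷ B) (a ∷ A) i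

earlierᶜ-≥ β α (b ∷ B) (a ∷ A) i = ≤-trans (+-monoˡ-≤ α (m≤m+n β b)) (earlierᶜ-cons-≥ β α b a B A i)
earlierᶜ-≥ β α []      _       i = ≤-refl
earlierᶜ-≥ β α (_ ∷ _) []      i = ≤-refl

earlierᶜ-cons-≥ β α b a B A i with i <? α + a
... | yes i<α+a = ≤-reflexive (sym (earlierᶜ-here β α b a B A i<α+a))
... | no  i≮α+a = ≤-trans (+-monoʳ-≤ (β + b) (m≤m+n α a))
                    (≤-trans (earlierᶜ-≥ (β + b) (α + a) B A i)
                             (≤-reflexive (sym (earlierᶜ-later β α b a B A (≮⇒≥ i≮α+a)))))

earlierᶜ-< : ∀ β α B A {i} → α ≤ i → i < α + sum A → earlierᶜ β α B A i < β + sum B + (α + sum A)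
earlierᶜ-< β α (b ∷ B) (a ∷ A) {i} α≤i i<α+ΣA with i <? α + a
... | yes i<α+a = begin-strict
  earlierᶜ β α (b ∷ B) (a ∷ A) i     ≡⟨ earlierᶜ-here β α b a B A i<α+a ⟩
  β + b + α                          <⟨ +-monoʳ-< (β + b) (m<m+n α (m≤o<m+n⇒0<n α≤i i<α+a)) ⟩
  β + b + (α + a)                    ≤⟨ +-mono-≤ (+-monoʳ-≤ β (m≤m+n b _)) (+-monoʳ-≤ α (m≤m+n a _)) ⟩
  β + (b + sum B) + (α + (a + sum A)) ∎
  where open ≤-Reasoning
... | no  i≮α+a = begin-strict
  earlierᶜ β α (b ∷ B) (a ∷ A) i     ≡⟨ earlierᶜ-later β α b a B A (≮⇒≥ i≮α+a) ⟩
  earlierᶜ (β + b) (α + a) B A i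
    <⟨ earlierᶜ-< (β + b) (α + a) B A (≮⇒≥ i≮α+a) (subst (i <_) (sym (+-assoc α a _)) i<α+ΣA) ⟩
  β + b + sum B + (α + a + sum A)    ≡⟨ cong₂ _+_ (+-assoc β b _) (+-assoc α a _) ⟩
  β + (b + sum B) + (α + (a + sum A)) ∎
  where open ≤-Reasoning
earlierᶜ-< β α B       []      α≤i i<α+0 = contradiction (≤-trans i<α+0 (≤-reflexive (+-identityʳ α))) (≤⇒≯ α≤i)
earlierᶜ-< β α []      (a ∷ A) α≤i i<α+ΣA = +-mono-≤-< (m≤m+n β 0) (m<m+n α (m≤o<m+n⇒0<n α≤i i<α+ΣA))

earlierᶜ-mono : ∀ β α B A {i i′} → i ≤ i′ → earlierᶜ β α B A i ≤ earlierᶜ β α B A i′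
earlierᶜ-mono β α (b ∷ B) (a ∷ A) {i} {i′} i≤i′ with i <? α + a
... | yes i<α+a = ≤-trans (≤-reflexive (earlierᶜ-here β α b a B A i<α+a)) (earlierᶜ-cons-≥ β α b a B A i′)
... | no  i≮α+a = begin
  earlierᶜ β α (b ∷ B) (a ∷ A) i     ≡⟨ earlierᶜ-later β α b a B A (≮⇒≥ i≮α+a) ⟩
  earlierᶜ (β + b) (α + a) B A i     ≤⟨ earlierᶜ-mono (β + b) (α + a) B A i≤i′ ⟩
  earlierᶜ (β + b) (α + a) B A i′    ≡⟨ earlierᶜ-later β α b a B A (≤-trans (≮⇒≥ i≮α+a) i≤i′) ⟨
  earlierᶜ β α (b ∷ B) (a ∷ A) i′    ∎
  where open ≤-Reasoning
earlierᶜ-mono β α []      _       _ = ≤-refl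
earlierᶜ-mono β α (_ ∷ _) []      _ = ≤-refl

module Realisation {n d : ℕ} (B A : List ℕ) where

  c0 : Config n d
  c0 (inj₁ i) = (n + d) ∸ suc (earlierᶜ 0 0 B A (toℕ i))
  c0 (inj₂ j) = n ∸ earlierᴵ 0 0 B A (toℕ j)

  c0-stable : Stable c0
  c0-stable (inj₁ i) = ∸-suc-< (≤-trans (≤-trans (s≤s z≤n) (Fin.toℕ<n i)) (m≤m+n n d))
    where
    ∸-suc-< : ∀ {m k} → 0 < m → m ∸ suc k < m
    ∸-suc-< {suc m} {k} _ = s≤s (m∸n≤m m k)
  c0-stable (inj₂ j) = ≤-trans (s≤s (m∸n≤m n (earlierᴵ 0 0 B A (toℕ j)))) (≤-reflexive (+-comm 1 n))

  c0-sorted : Sorted c0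
  c0-sorted = (λ i i′ i≤i′ → ∸-monoʳ-≤ (n + d) (s≤s (earlierᶜ-mono 0 0 B A i≤i′)))
            , (λ j j′ j≤j′ → ∸-monoʳ-≤ n (earlierᴵ-mono 0 0 B A j≤j′))

  toppledFirst : ℕ → ℕ → VertexSet n d
  toppledFirst β α (inj₁ i) = toℕ i <ᵇ α
  toppledFirst β α (inj₂ j) = toℕ j <ᵇ β

  neighboursIn-toppledFirst-indep : ∀ {β α} → α ≤ n → ∀ j → neighboursIn (toppledFirst β α) (inj₂ j) ≡ α
  neighboursIn-toppledFirst-indep {β} {α} α≤n j =
    cong₂ _+_ {y = α} {v = 0} (trans (countFin-cong {n} (λ i → ∧-identityʳ (toℕ i <ᵇ α))) (countFin-<ᵇ α≤n))
                              (none⇒countFin≡0 {d} (λ j′ → ∧-zeroʳ (toℕ j′ <ᵇ β)))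
      ⟨ trans ⟩ +-identityʳ α

  neighboursIn-toppledFirst-clique : ∀ {β α} → α ≤ n → β ≤ d → ∀ i → α ≤ toℕ i →
                                     neighboursIn (toppledFirst β α) (inj₁ i) ≡ α + β
  neighboursIn-toppledFirst-clique {β} {α} α≤n β≤d i α≤i =
    cong₂ _+_ (trans (countFin-cong {n} others) (countFin-<ᵇ α≤n))
              (trans (countFin-cong {d} (λ j → ∧-identityʳ (toℕ j <ᵇ β))) (countFin-<ᵇ β≤d))
    where
    others : ∀ i′ → (toℕ i′ <ᵇ α) ∧ not ⌊ i′ Fin.≟ i ⌋ ≡ (toℕ i′ <ᵇ α)
    others i′ with i′ Fin.≟ i
    ... | yes refl = trans (∧-zeroʳ _) (sym (<ᵇ-false α≤i))
    ... | no  _    = ∧-identityʳ _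

  open Toppling c0
  open FromStable c0-stable

  -- B′ and A′ are the blocks left after the first β independent and α clique vertices.
  record Schedule (β α : ℕ) (B′ A′ : List ℕ) : Set where
    field
      indep-total    : β + sum B′ ≡ d
      clique-total   : α + sum A′ ≡ n
      indep-earlier  : ∀ j → β ≤ j → earlierᴵ 0 0 B A j ≡ earlierᴵ β α B′ A′ j
      clique-earlier : ∀ i → α ≤ i → earlierᶜ 0 0 B A i ≡ earlierᶜ β α B′ A′ i

  schedule-start : sum B ≡ d → sum A ≡ n → Schedule 0 0 B A
  schedule-start ΣB≡d ΣA≡n = record
    { indep-total = ΣB≡d ; clique-total = ΣA≡n ; indep-earlier = λ _ _ → refl ; clique-earlier = λ _ _ → refl }

  schedule-next : ∀ {β α b a B′ A′} → Schedule β α (b ∷ B′) (a ∷ A′) → Schedule (β + b) (α + a) B′ A′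
  schedule-next {β} {α} {b} {a} {B′} {A′} sch = record
    { indep-total    = trans (+-assoc β b _) indep-total
    ; clique-total   = trans (+-assoc α a _) clique-total
    ; indep-earlier  = λ j β+b≤j →
        trans (indep-earlier j (≤-trans (m≤m+n β b) β+b≤j)) (earlierᴵ-later β α b a B′ A′ β+b≤j)
    ; clique-earlier = λ i α+a≤i →
        trans (clique-earlier i (≤-trans (m≤m+n α a) α+a≤i)) (earlierᶜ-later β α b a B′ A′ α+a≤i)
    }
    where open Schedule sch

  module Stage {β α b a B′ A′} (adm : Admissible (b ∷ B′) (a ∷ A′))
               (sch : Schedule β α (b ∷ B′) (a ∷ A′)) where
    open Schedule sch

    β+b≤d : β + b ≤ d
    β+b≤d = ≤-trans (m≤m+n (β + b) (sum B′)) (≤-reflexive (trans (+-assoc β b _) indep-total))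

    α+a≤n : α + a ≤ n
    α+a≤n = ≤-trans (m≤m+n (α + a) (sum A′)) (≤-reflexive (trans (+-assoc α a _) clique-total))

    β≤d : β ≤ d
    β≤d = ≤-trans (m≤m+n β b) β+b≤d

    α≤n : α ≤ n
    α≤n = ≤-trans (m≤m+n α a) α+a≤n

    beyond-indep : (j : Fin d) → β + b ≤ toℕ j → 0 < a
    beyond-indep j β+b≤j with admissible-head adm
    ... | inj₁ a>0          = a>0
    ... | inj₂ (refl , _) = contradiction (Fin.toℕ<n j) (≤⇒≯ (≤-trans (≤-reflexive d≡β+b) β+b≤j))
      where
      d≡β+b : d ≡ β + b
      d≡β+b = trans (sym indep-total) (cong (β +_) (+-identityʳ b))

    beyond-clique : (i : Fin n) → α + a ≤ toℕ i → 0 < a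
    beyond-clique i α+a≤i with admissible-head adm
    ... | inj₁ a>0          = a>0
    ... | inj₂ (_ , refl) = contradiction (Fin.toℕ<n i) (≤⇒≯ (≤-trans (≤-reflexive n≡α+a) α+a≤i))
      where
      n≡α+a : n ≡ α + a
      n≡α+a = trans (sym clique-total) (cong (α +_) (+-identityʳ a))

    indep-threshold : (j : Fin d) → β ≤ toℕ j → (n + 1 ≤ suc (c0 (inj₂ j)) + α ⇔ toℕ j < β + b)
    indep-threshold j β≤j = ⇔.trans shift (⇔.trans (≤-∸-+⇔ e≤n) e≤α⇔)
      where
      e : ℕ
      e = earlierᴵ β α (b ∷ B′) (a ∷ A′) (toℕ j)
      c0≡ : c0 (inj₂ j) ≡ n ∸ e
      c0≡ = cong (n ∸_) (indep-earlier (toℕ j) β≤j)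
      shift : n + 1 ≤ suc (c0 (inj₂ j)) + α ⇔ n ≤ (n ∸ e) + α
      shift = mk⇔ (λ le → s≤s⁻¹ (subst₂ _≤_ (+-comm n 1) (cong (λ m → suc m + α) c0≡) le))
                  (λ le → subst₂ _≤_ (+-comm 1 n) (cong (λ m → suc m + α) (sym c0≡)) (s≤s le))
      e≤n : e ≤ n
      e≤n = ≤-trans (earlierᴵ-≤ β α (b ∷ B′) (a ∷ A′) (toℕ j)) (≤-reflexive clique-total)
      e≤α⇔ : e ≤ α ⇔ toℕ j < β + b
      e≤α⇔ = mk⇔ to (λ j<β+b → ≤-reflexive (earlierᴵ-here β α b a B′ A′ j<β+b))
        where
        to : e ≤ α → toℕ j < β + b
        to e≤α with toℕ j <? β + b
        ... | yes j<β+b = j<β+b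
        ... | no  j≮β+b = contradiction
          (≤-trans (earlierᴵ-≥ (β + b) (α + a) B′ A′ (toℕ j))
                   (≤-trans (≤-reflexive (sym (earlierᴵ-later β α b a B′ A′ (≮⇒≥ j≮β+b)))) e≤α))
          (<⇒≱ (m<m+n α (beyond-indep j (≮⇒≥ j≮β+b))))

    clique-threshold : (i : Fin n) → α ≤ toℕ i → (n + d ≤ suc (c0 (inj₁ i)) + (α + (β + b)) ⇔ toℕ i < α + a)
    clique-threshold i α≤i = ⇔.trans shift (⇔.trans (≤-∸-+⇔ h<n+d) (⇔.trans (mk⇔ s≤s⁻¹ s≤s) h≤⇔))
      where
      h : ℕ
      h = earlierᶜ β α (b ∷ B′) (a ∷ A′) (toℕ i)
      c0≡ : c0 (inj₁ i) ≡ (n + d) ∸ suc h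
      c0≡ = cong (λ m → (n + d) ∸ suc m) (clique-earlier (toℕ i) α≤i)
      grains≡ : suc (c0 (inj₁ i)) + (α + (β + b)) ≡ ((n + d) ∸ suc h) + suc (α + (β + b))
      grains≡ = trans (cong (λ m → suc m + (α + (β + b))) c0≡) (sym (+-suc _ _))
      shift : n + d ≤ suc (c0 (inj₁ i)) + (α + (β + b)) ⇔ n + d ≤ ((n + d) ∸ suc h) + suc (α + (β + b))
      shift = mk⇔ (subst (n + d ≤_) grains≡) (subst (n + d ≤_) (sym grains≡))
      h<n+d : suc h ≤ n + d
      h<n+d = ≤-trans (earlierᶜ-< β α (b ∷ B′) (a ∷ A′) α≤i
                                  (subst (toℕ i <_) (sym clique-total) (Fin.toℕ<n i)))
                      (≤-reflexive (trans (cong₂ _+_ indep-total clique-total) (+-comm d n)))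
      h≤⇔ : h ≤ α + (β + b) ⇔ toℕ i < α + a
      h≤⇔ = mk⇔ to (λ i<α+a → ≤-reflexive (trans (earlierᶜ-here β α b a B′ A′ i<α+a) (+-comm (β + b) α)))
        where
        to : h ≤ α + (β + b) → toℕ i < α + a
        to h≤ with toℕ i <? α + a
        ... | yes i<α+a = i<α+a
        ... | no  i≮α+a = contradiction
          (+-cancelˡ-≤ (β + b) _ _ (≤-trans (earlierᶜ-≥ (β + b) (α + a) B′ A′ (toℕ i))
            (≤-trans (≤-reflexive (sym (earlierᶜ-later β α b a B′ A′ (≮⇒≥ i≮α+a))))
                     (≤-trans h≤ (≤-reflexive (+-comm α (β + b)))))))
          (<⇒≱ (m<m+n α (beyond-clique i (≮⇒≥ i≮α+a))))

    module _ {c : Config n d} (t : Toppled (toppledFirst β α) c) where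

      Q-phase : toppledFirst β α ∪ Qset c ≗ toppledFirst (β + b) α
      Q-phase (inj₁ i) = ∨-identityʳ (toℕ i <ᵇ α)
      Q-phase (inj₂ j) =
        does-⇔ (extend⇔ unstable⇔) ((toℕ j <? β) ⊎-dec (n + 1 ≤? c (inj₂ j))) (toℕ j <? β + b)
        where
        unstable⇔ : β ≤ toℕ j → (n + 1 ≤ c (inj₂ j) ⇔ toℕ j < β + b)
        unstable⇔ β≤j = subst (λ m → n + 1 ≤ m ⇔ toℕ j < β + b) (sym grains) (indep-threshold j β≤j)
          where
          grains : c (inj₂ j) ≡ suc (c0 (inj₂ j)) + α
          grains = trans (toppled-outside t {inj₂ j} (<ᵇ-false β≤j))
                         (cong (suc (c0 (inj₂ j)) +_) (neighboursIn-toppledFirst-indep {β = β} α≤n j))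

      P-phase : Toppled (toppledFirst (β + b) α) (afterQ c) →
                toppledFirst (β + b) α ∪ Pset c ≗ toppledFirst (β + b) (α + a)
      P-phase t′ (inj₁ i) =
        does-⇔ (extend⇔ unstable⇔) ((toℕ i <? α) ⊎-dec (n + d ≤? afterQ c (inj₁ i))) (toℕ i <? α + a)
        where
        unstable⇔ : α ≤ toℕ i → (n + d ≤ afterQ c (inj₁ i) ⇔ toℕ i < α + a)
        unstable⇔ α≤i = subst (λ m → n + d ≤ m ⇔ toℕ i < α + a) (sym grains) (clique-threshold i α≤i)
          where
          grains : afterQ c (inj₁ i) ≡ suc (c0 (inj₁ i)) + (α + (β + b))
          grains = trans (toppled-outside t′ {inj₁ i} (<ᵇ-false α≤i))
                         (cong (suc (c0 (inj₁ i)) +_) (neighboursIn-toppledFirst-clique {β = β + b} α≤n β+b≤d i α≤i))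
      P-phase t′ (inj₂ j) = ∨-identityʳ (toℕ j <ᵇ β + b)

      round-toppledFirst : toppledFirst β α ∪ Qset c ∪ Pset c ≗ toppledFirst (β + b) (α + a)
      round-toppledFirst x = trans (cong (_∨ Pset c x) (Q-phase x)) (P-phase (Toppled-cong Q-phase (afterQ-toppled t)) x)

      stage-toppled : Toppled (toppledFirst (β + b) (α + a)) (afterRound c)
      stage-toppled = Toppled-cong round-toppledFirst (afterRound-toppled t)

      stage-qRound : qRound c ≡ b
      stage-qRound = +-cancelˡ-≡ β _ _ (begin
        β + qRound c                                         ≡⟨ cong (_+ qRound c) (countFin-<ᵇ β≤d) ⟨
        indepCount (toppledFirst β α) + qRound c             ≡⟨ round-indepCount t ⟨
        indepCount (toppledFirst β α ∪ Qset c ∪ Pset c)      ≡⟨ countFin-cong (round-toppledFirst ∘ inj₂) ⟩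
        indepCount (toppledFirst (β + b) (α + a))            ≡⟨ countFin-<ᵇ β+b≤d ⟩
        β + b                                                ∎)
        where open ≡-Reasoning

      stage-pRound : pRound c ≡ a
      stage-pRound = +-cancelˡ-≡ α _ _ (begin
        α + pRound c                                         ≡⟨ cong (_+ pRound c) (countFin-<ᵇ α≤n) ⟨
        cliqueCount (toppledFirst β α) + pRound c            ≡⟨ round-cliqueCount t ⟨
        cliqueCount (toppledFirst β α ∪ Qset c ∪ Pset c)     ≡⟨ countFin-cong (round-toppledFirst ∘ inj₁) ⟩
        cliqueCount (toppledFirst (β + b) (α + a))           ≡⟨ countFin-<ᵇ α+a≤n ⟩
        α + a                                                ∎)
        where open ≡-Reasoning

  scheduled-run : ∀ {β α B′ A′} {c : Config n d} → Admissible B′ A′ → Schedule β α B′ A′ →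
        Toppled (toppledFirst β α) c → ITCFrom c B′ A′
  scheduled-run {β} {α} {c = c} adm@(final {b} {a} _) sch t =
    subst₂ (λ q p → ITCFrom c (q ∷ []) (p ∷ [])) (stage-qRound t) (stage-pRound t)
           (stop (λ x → toppled-stable (stage-toppled t) {x} (everything x)))
    where
    open Stage adm sch
    open Schedule sch
    everything : ∀ x → toppledFirst (β + b) (α + a) x ≡ true
    everything (inj₁ i) = <ᵇ-true (subst (toℕ i <_) (trans (sym clique-total) (cong (α +_) (+-identityʳ a)))
                                         (Fin.toℕ<n i))
    everything (inj₂ j) = <ᵇ-true (subst (toℕ j <_) (trans (sym indep-total) (cong (β +_) (+-identityʳ b)))
                                         (Fin.toℕ<n j))
  scheduled-run {c = c} adm@(_∷_ {qs = B′} {ps = A′} _ adm′) sch t =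
    subst₂ (λ q p → ITCFrom c (q ∷ B′) (p ∷ A′)) (stage-qRound t) (stage-pRound t)
           (more (run-unstable next adm′) next)
    where
    open Stage adm sch
    next : ITCFrom (afterRound c) B′ A′
    next = scheduled-run adm′ (schedule-next sch) (stage-toppled t)

  admissible⇒InITC : Admissible B A → sum B ≡ d → sum A ≡ n → InITC n d B A
  admissible⇒InITC adm ΣB≡d ΣA≡n = c0 , (c0-sorted , itc-sums⇒recurrent c0-stable r ΣB≡d ΣA≡n) , r
    where
    r : ITCFrom (toppleSink c0) B A
    r = scheduled-run adm (schedule-start ΣB≡d ΣA≡n)
                      (Toppled-cong (λ { (inj₁ _) → refl ; (inj₂ _) → refl }) toppleSink-toppled)

ITCShape : ℕ → ℕ → List ℕ → List ℕ → Set
ITCShape n d bs as =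
  (bs ≡ d ∷ [] × as ≡ n ∷ [])
  ⊎ (∃[ bs′ ] ∃[ as′ ] ∃[ bk ] ∃[ ak ]
       (bs ≡ bs′ ++ bk ∷ [] × as ≡ as′ ++ ak ∷ []
       × 1 ≤ length bs′ × length as′ ≡ length bs′
       × sum bs ≡ d × sum as ≡ n
       × All (0 <_) as′ × 0 < bk + ak))

itc⇒shape : ∀ {qs ps} → InITC n d qs ps → ITCShape n d qs ps
itc⇒shape {n} {d} (c0 , (_ , recurrent@(stable , _)) , r) = shape r (recurrent⇒itc-sums recurrent r)
  where
  open Toppling c0
  open FromStable stable
  shape : ∀ {qs ps} → ITCFrom (toppleSink c0) qs ps → sum qs ≡ d × sum ps ≡ n → ITCShape n d qs ps
  shape (stop _) (Σqs≡d , Σps≡n) =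
    inj₁ (cong (_∷ []) (trans (sym (+-identityʳ _)) Σqs≡d) , cong (_∷ []) (trans (sym (+-identityʳ _)) Σps≡n))
  shape (more unstable r′) (Σqs≡d , Σps≡n)
    with admissible⇒snoc (run-admissible (afterRound-toppled toppleSink-toppled) r′ unstable)
  ... | qs′ , ps′ , q , p , refl , refl , len , pos , last-pos =
    inj₂ (_ ∷ qs′ , _ ∷ ps′ , q , p , refl , refl , s≤s z≤n , cong suc len , Σqs≡d , Σps≡n ,
          more⇒pRound-pos toppleSink-toppled unstable ∷ pos , last-pos)

shape⇒itc : ∀ {qs ps} → 1 ≤ n → ITCShape n d qs ps → InITC n d qs ps
shape⇒itc {n} {d} 1≤n (inj₁ (refl , refl)) =
  Realisation.admissible⇒InITC (d ∷ []) (n ∷ []) (final (≤-trans 1≤n (m≤n+m n d))) (+-identityʳ d) (+-identityʳ n)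
shape⇒itc _ (inj₂ (qs′ , ps′ , q , p , refl , refl , _ , len , Σqs≡d , Σps≡n , pos , last-pos)) =
  Realisation.admissible⇒InITC _ _ (snoc⇒admissible qs′ ps′ len pos last-pos) Σqs≡d Σps≡n

theorem2p7 : ∀ (n d : ℕ) → 1 ≤ n → ∀ (bs as : List ℕ) →
    InITC n d bs as ⇔
      ((bs ≡ d ∷ [] × as ≡ n ∷ [])
      ⊎ (∃[ bs′ ] ∃[ as′ ] ∃[ bk ] ∃[ ak ]
           (bs ≡ bs′ ++ bk ∷ [] × as ≡ as′ ++ ak ∷ []
           × 1 ≤ length bs′ × length as′ ≡ length bs′
           × sum bs ≡ d × sum as ≡ n
           × All (0 <_) as′ × 0 < bk + ak)))
theorem2p7 n d 1≤n bs as = mk⇔ itc⇒shape (shape⇒itc 1≤n)
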